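{- Let $n$, $a$, $k$, $s$ be integers with $n=k(a-1)+s$, $a\ge 4$ and $0\le s\le \min\{a,k\}-2$. Then (1) if $s=0$, $\beta_b(\overrightarrow{C}(n;1,a))\ge k(a-2)$; (2) if $s=1$, $\beta_b(\overrightarrow{C}(n;1,a))\ge (k-1)(a-2)+1$; (3) if $s\ge 2$, $\beta_b(\overrightarrow{C}(n;1,a))\ge (k-s)(a-2)+(s-1)(s+1)$.
   Context: The oriented circulant graph $\overrightarrow{C}(n;1,a)$ has vertex set $\{v_0,\dots,v_{n-1}\}$ and arcs $v_iv_{i+1}$, $v_iv_{i+a}$, subscripts modulo $n$. $d(u,v)$ is the length of a shortest directed path from $u$ to $v$; $e(v)=\max_u d(v,u)$; $\mathrm{diam}$ is the maximum eccentricity. An independent broadcast is $f:V\to\{0,\dots,\mathrm{diam}\}$ with $f(v)\le e(v)$ for all $v$ and $d(u,v)>f(u)$ for all distinct $u,v$ with $f(u),f(v)>0$; its cost is $\sigma(f)=\sum_v f(v)$, and $\beta_b$ is the maximum cost of an independent broadcast. -}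

module Defs where

open import Data.Nat using (ℕ; zero; suc; _+_; _*_; _≤_; _<_)
open import Data.Fin using (Fin; toℕ)
open import Data.List using (map; allFin)
open import Data.Nat.ListAction using (sum)
open import Data.Product using (Σ; ∃; _×_)
open import Data.Sum using (_⊎_)
open import Relation.Nullary using (¬_)
open import Relation.Binary.PropositionalEquality using (_≡_; _≢_)

-- Oriented circulant graph C(n;1,a): vertices v_0..v_{n-1} (as Fin n),
-- arcs v_i v_{i+1} and v_i v_{i+a}, subscripts modulo n.
-- "j ≡ i + c (mod n)" with j < n is written  i + c = j + q * n  for some q.
Arc : (n a : ℕ) → Fin n → Fin n → Set
Arc n a u v = (∃ λ q → toℕ u + 1 ≡ toℕ v + q * n)
            ⊎ (∃ λ q → toℕ u + a ≡ toℕ v + q * n)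

data Walk (n a : ℕ) : Fin n → Fin n → ℕ → Set where
  here : ∀ {u} → Walk n a u u 0
  step : ∀ {u w v m} → Arc n a u w → Walk n a w v m → Walk n a u v (suc m)

DistGt : (n a : ℕ) → Fin n → Fin n → ℕ → Set
DistGt n a u v r = ∀ m → m ≤ r → ¬ Walk n a u v m

DistGe : (n a : ℕ) → Fin n → Fin n → ℕ → Set
DistGe n a u v r = ∀ m → m < r → ¬ Walk n a u v m

EccGe : (n a : ℕ) → Fin n → ℕ → Set
EccGe n a v r = ∃ λ u → DistGe n a v u r

-- Independent broadcast f : V → ℕ.
-- (f v ≤ e v ≤ diam, so the codomain bound {0..diam} is implied.)
IndependentBroadcast : (n a : ℕ) → (Fin n → ℕ) → Set
IndependentBroadcast n a f =
  (∀ v → EccGe n a v (f v))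
  × (∀ u v → u ≢ v → 0 < f u → 0 < f v → DistGt n a u v (f u))

cost : {n : ℕ} → (Fin n → ℕ) → ℕ
cost {n} f = sum (map f (allFin n))

IsBetaB : (n a : ℕ) → ℕ → Set
IsBetaB n a b =
  (∃ λ f → IndependentBroadcast n a f × cost f ≡ b)
  × (∀ f → IndependentBroadcast n a f → cost f ≤ b)

-- Write a = c + 1, so n = k·c + s. A walk of length m using j arcs of length a moves a vertex
-- by m + j·c (mod n), with j ≤ m. The broadcasts are spaced: vertex i·c gets a value w i ≤ c,
-- every other vertex gets 0.
-- Each vertex v has eccentricity at least c: reaching v + c would need m + j·c ≡ c (mod n)
-- with j ≤ m < c, which s ≤ k rules out.
-- For independence, write i·c + m + j·c = i'·c + q·n with i ≠ i' and j ≤ m ≤ w i, and compare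
-- multiples of c: either m ≥ c, or q ≥ 1 with m + t·c = q·s and i + j ≥ q·k for some t. The
-- latter is impossible when i + s < k, as then i + m ≥ i + j ≥ q·k ≥ q·s + i + 1 > i + m;
-- these i get c - 1. It is also impossible when m < s < c and i ≤ k, so the last s + 1
-- multiples may get s - 1. For s = 1 the vertex (k - 2)·c may even get c: with m = c and
-- q = 0 it only reaches the silent multiples (k - 1)·c, k·c, ...

module Submission where

open import Defs
open import Data.Nat
open import Data.Nat.Properties
open import Data.Nat.Divisibility using (_∣?_; divides)
open import Data.Nat.DivMod using (_/_; m%n<n; m≡m%n+[m/n]*n)
open import Data.Nat.ListAction using (sum)
open import Data.Nat.Tactic.RingSolver using (solve-∀)
open import Data.Fin using (Fin; toℕ; fromℕ<)
open import Data.Fin.Properties using (toℕ<n; toℕ-fromℕ<; toℕ-injective)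
open import Data.List using (tabulate)
open import Data.List.Properties using (map-tabulate)
open import Data.Product using (_×_; _,_; ∃; ∃₂)
open import Data.Sum using (_⊎_; inj₁; inj₂)
open import Data.Empty using (⊥; ⊥-elim)
open import Function using (_∘_; id)
open import Relation.Nullary using (yes; no; contradiction)
open import Relation.Binary.PropositionalEquality
open import Algebra.Properties.CommutativeSemigroup +-commutativeSemigroup using (xy∙z≈xz∙y)

m+x*c≡r+y*c-cases : ∀ m x c r y → m + x * c ≡ r + y * c →
    (∃ λ t → x ≡ y + t × m + t * c ≡ r)
  ⊎ (∃ λ t → y ≡ x + suc t × m ≡ r + suc t * c)
m+x*c≡r+y*c-cases m x c r y eq with ≤-<-connex y x
... | inj₁ y≤x with m≤n⇒∃[o]m+o≡n y≤x
...   | t , refl = inj₁ (t , refl , +-cancelʳ-≡ (y * c) _ _ (trans (regroup m y t c) eq))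
  where
  regroup : ∀ m y t c → (m + t * c) + y * c ≡ m + (y + t) * c
  regroup = solve-∀
m+x*c≡r+y*c-cases m x c r y eq | inj₂ x<y with m≤n⇒∃[o]m+o≡n x<y
...   | t , refl = inj₂ (t , sym (+-suc x t) , +-cancelʳ-≡ (x * c) _ _ (trans eq (regroup r x t c)))
  where
  regroup : ∀ r x t c → r + (suc x + t) * c ≡ (r + suc t * c) + x * c
  regroup = solve-∀

+-cross-cancel : ∀ y t {a b p q} → y + a ≡ t + p → y + b ≡ t + q → a + q ≡ b + p
+-cross-cancel y t {a} {b} {p} {q} ya≡ yb≡ = +-cancelˡ-≡ y _ _ (begin
  y + (a + q)   ≡⟨ +-assoc y a q ⟨
  y + a + q     ≡⟨ cong (_+ q) ya≡ ⟩
  t + p + q     ≡⟨ xy∙z≈xz∙y t p q ⟩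
  t + q + p     ≡⟨ cong (_+ p) yb≡ ⟨
  y + b + p     ≡⟨ +-assoc y b p ⟩
  y + (b + p)   ∎)
  where open ≡-Reasoning

shift-trans : ∀ x y z d e p q n → x + d ≡ y + p * n → y + e ≡ z + q * n →
  x + (d + e) ≡ z + (p + q) * n
shift-trans x y z d e p q n xd≡ ye≡ = begin
  x + (d + e)         ≡⟨ +-assoc x d e ⟨
  x + d + e           ≡⟨ cong (_+ e) xd≡ ⟩
  y + p * n + e       ≡⟨ xy∙z≈xz∙y y (p * n) e ⟩
  y + e + p * n       ≡⟨ cong (_+ p * n) ye≡ ⟩
  z + q * n + p * n   ≡⟨ collect z q p n ⟩
  z + (p + q) * n     ∎
  where
  open ≡-Reasoning
  collect : ∀ z q p n → z + q * n + p * n ≡ z + (p + q) * n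
  collect = solve-∀

walk-displacement : ∀ {n c u v m} → Walk n (suc c) u v m →
  ∃₂ λ j q → j ≤ m × toℕ u + (m + j * c) ≡ toℕ v + q * n
walk-displacement here = 0 , 0 , z≤n , refl
walk-displacement {n} {c} (step {u} {w} {v} {m} arc walk) with walk-displacement walk
... | j , q , j≤m , w↝v = extend arc
  where
  extend : Arc n (suc c) u w →
    ∃₂ λ j' q' → j' ≤ suc m × toℕ u + (suc m + j' * c) ≡ toℕ v + q' * n
  extend (inj₁ (p , u+1≡)) = j , p + q , m≤n⇒m≤1+n j≤m ,
    shift-trans (toℕ u) (toℕ w) (toℕ v) 1 (m + j * c) p q n u+1≡ w↝v
  extend (inj₂ (p , u+a≡)) = suc j , p + q , s≤s j≤m ,
    trans (cong (toℕ u +_) (regroup m j c))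
          (shift-trans (toℕ u) (toℕ w) (toℕ v) (suc c) (m + j * c) p q n u+a≡ w↝v)
    where
    regroup : ∀ m j c → suc m + suc j * c ≡ suc c + (m + j * c)
    regroup = solve-∀

no-short-walk-to-+c : ∀ {c k s m j} r → s ≤ k → j ≤ m → m < c →
  m + j * c ≢ c + r * (k * c + s)
no-short-walk-to-+c {c} {k} {s} {m} {j} r s≤k j≤m m<c eq
  with m+x*c≡r+y*c-cases m j c (r * s) (suc (r * k)) (trans eq (regroup c r k s))
  where
  regroup : ∀ c r k s → c + r * (k * c + s) ≡ r * s + suc (r * k) * c
  regroup = solve-∀
... | inj₁ (t , refl , m+tc≡rs) = n≮n (r * k) (begin-strict
  r * k                 <⟨ ≤-refl ⟩
  suc (r * k)           ≤⟨ m≤m+n _ t ⟩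
  suc (r * k) + t       ≤⟨ j≤m ⟩
  m                     ≤⟨ m≤m+n m (t * c) ⟩
  m + t * c             ≡⟨ m+tc≡rs ⟩
  r * s                 ≤⟨ *-monoʳ-≤ r s≤k ⟩
  r * k                 ∎)
  where open ≤-Reasoning
... | inj₂ (t , _ , refl) = <⇒≱ m<c (≤-trans (m≤m+n c (t * c)) (m≤n+m _ (r * s)))

eccentricity-≥ : ∀ {c k s} → s ≤ k → c < k * c + s → (v : Fin (k * c + s)) →
  EccGe (k * c + s) (suc c) v c
eccentricity-≥ {c} {k} {s} s≤k c<n v = target , no-short-walk
  where
  n = k * c + s
  instance
    n≢0 : NonZero n
    n≢0 = >-nonZero (≤-<-trans z≤n c<n)
  x = toℕ v + c
  target : Fin n
  target = fromℕ< (m%n<n x n)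
  x≡target : x ≡ toℕ target + x / n * n
  x≡target = trans (m≡m%n+[m/n]*n x n) (cong (_+ x / n * n) (sym (toℕ-fromℕ< (m%n<n x n))))
  no-short-walk : DistGe n (suc c) v target c
  no-short-walk m m<c walk with walk-displacement walk
  ... | j , q , j≤m , v↝target
    with m+x*c≡r+y*c-cases c q n (m + j * c) (x / n)
           (+-cross-cancel (toℕ v) (toℕ target) x≡target v↝target)
  ... | inj₁ (r , _ , c+rn≡) = no-short-walk-to-+c r s≤k j≤m m<c (sym c+rn≡)
  ... | inj₂ (r , _ , c≡) =
    <⇒≱ c<n (subst (n ≤_) (sym c≡) (≤-trans (m≤m+n n (r * n)) (m≤n+m _ (m + j * c))))

sumBelow : ℕ → (ℕ → ℕ) → ℕ
sumBelow zero g = 0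
sumBelow (suc N) g = sumBelow N g + g N

sumBelow-+ : ∀ A B g → sumBelow (A + B) g ≡ sumBelow A g + sumBelow B (λ i → g (A + i))
sumBelow-+ A zero g = trans (cong (λ N → sumBelow N g) (+-identityʳ A)) (sym (+-identityʳ _))
sumBelow-+ A (suc B) g = begin
  sumBelow (A + suc B) g                                   ≡⟨ cong (λ N → sumBelow N g) (+-suc A B) ⟩
  sumBelow (A + B) g + g (A + B)                           ≡⟨ cong (_+ g (A + B)) (sumBelow-+ A B g) ⟩
  sumBelow A g + sumBelow B (λ i → g (A + i)) + g (A + B)  ≡⟨ +-assoc (sumBelow A g) _ _ ⟩
  sumBelow A g + sumBelow (suc B) (λ i → g (A + i))        ∎
  where open ≡-Reasoning

sumBelow-mono : ∀ g {M N} → M ≤ N → sumBelow M g ≤ sumBelow N g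
sumBelow-mono g {M} M≤N with m≤n⇒∃[o]m+o≡n M≤N
... | d , refl = subst (sumBelow M g ≤_) (sym (sumBelow-+ M d g)) (m≤m+n _ _)

sumBelow-const : ∀ N g {x} → (∀ i → i < N → g i ≡ x) → sumBelow N g ≡ N * x
sumBelow-const zero g _ = refl
sumBelow-const (suc N) g {x} g≡x = trans
  (cong₂ _+_ (sumBelow-const N g (λ i i<N → g≡x i (m<n⇒m<1+n i<N))) (g≡x N ≤-refl))
  (+-comm (N * x) x)

cost-toℕ : ∀ N g → cost {N} (g ∘ toℕ) ≡ sumBelow N g
cost-toℕ N g = trans (cong sum (map-tabulate {n = N} id (g ∘ toℕ))) (sum-tabulate N g)
  where
  sum-tabulate : ∀ N g → sum (tabulate {n = N} (g ∘ toℕ)) ≡ sumBelow N g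
  sum-tabulate zero g = refl
  sum-tabulate (suc N) g =
    trans (cong (g 0 +_) (sum-tabulate N (g ∘ suc))) (sym (sumBelow-+ 1 N g))

spaced : ℕ → (ℕ → ℕ) → ℕ → ℕ
spaced c w x with c ∣? x
... | yes (divides i _) = w i
... | no _ = 0

spaced-positive : ∀ {c w x} → 0 < spaced c w x → ∃ λ i → x ≡ i * c × spaced c w x ≡ w i
spaced-positive {c} {w} {x} pos with c ∣? x
... | yes (divides i x≡ic) = i , x≡ic , refl

spaced-at : ∀ {c} .{{_ : NonZero c}} w i → spaced c w (i * c) ≡ w i
spaced-at {c} w i with c ∣? i * c
... | yes (divides i' ic≡i'c) = cong w (*-cancelʳ-≡ i' i c (sym ic≡i'c))
... | no c∤ic = contradiction (divides i refl) c∤ic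

spaced-≤ : ∀ {c w B} → (∀ i → w i ≤ B) → ∀ x → spaced c w x ≤ B
spaced-≤ {c} {w} w≤B x with c ∣? x
... | yes (divides i _) = w≤B i
... | no _ = z≤n

sumBelow-spaced : ∀ {c} .{{_ : NonZero c}} w K →
  sumBelow (suc K) w ≤ sumBelow (suc (K * c)) (spaced c w)
sumBelow-spaced w zero = ≤-reflexive (sym (spaced-at w 0))
sumBelow-spaced {c} w (suc K) = +-mono-≤
  (≤-trans (sumBelow-spaced w K) (sumBelow-mono (spaced c w) (+-monoˡ-≤ (K * c) (>-nonZero⁻¹ c))))
  (≤-reflexive (sym (spaced-at w (suc K))))

cost-spaced : ∀ {c n} .{{_ : NonZero c}} w K → K * c < n →
  sumBelow (suc K) w ≤ cost {n} (spaced c w ∘ toℕ)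
cost-spaced {c} {n} w K Kc<n = begin
  sumBelow (suc K) w                   ≤⟨ sumBelow-spaced w K ⟩
  sumBelow (suc (K * c)) (spaced c w)  ≤⟨ sumBelow-mono (spaced c w) Kc<n ⟩
  sumBelow n (spaced c w)              ≡⟨ cost-toℕ n (spaced c w) ⟨
  cost {n} (spaced c w ∘ toℕ)          ∎
  where open ≤-Reasoning

CollisionFree : (c n : ℕ) → (ℕ → ℕ) → Set
CollisionFree c n w = ∀ {i i' m j} q → i ≢ i' → 0 < w i → 0 < w i' → i * c < n →
  j ≤ m → m ≤ w i → i * c + (m + j * c) ≢ i' * c + q * n

spaced-independent : ∀ {c k s w} .{{_ : NonZero c}} → s ≤ k → c < k * c + s → (∀ i → w i ≤ c) →
  CollisionFree c (k * c + s) w → IndependentBroadcast (k * c + s) (suc c) (spaced c w ∘ toℕ)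
spaced-independent {c} {k} {s} {w} s≤k c<n w≤c collision-free = within-eccentricity , independent
  where
  n = k * c + s
  f = spaced c w ∘ toℕ
  within-eccentricity : ∀ v → EccGe n (suc c) v (f v)
  within-eccentricity v with eccentricity-≥ s≤k c<n v
  ... | u , far = u , λ m m<fv → far m (<-≤-trans m<fv (spaced-≤ {c} w≤c (toℕ v)))
  independent : ∀ u v → u ≢ v → 0 < f u → 0 < f v → DistGt n (suc c) u v (f u)
  independent u v u≢v fu>0 fv>0 m m≤fu walk
    with spaced-positive fu>0 | spaced-positive fv>0 | walk-displacement walk
  ... | i , u≡ic , fu≡wi | i' , v≡i'c , fv≡wi' | j , q , j≤m , u↝v =
    collision-free q i≢i' (subst (0 <_) fu≡wi fu>0) (subst (0 <_) fv≡wi' fv>0)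
      (subst (_< n) u≡ic (toℕ<n u)) j≤m (subst (m ≤_) fu≡wi m≤fu)
      (subst₂ (λ x y → x + (m + j * c) ≡ y + q * n) u≡ic v≡i'c u↝v)
    where
    i≢i' : i ≢ i'
    i≢i' i≡i' = u≢v (toℕ-injective (trans u≡ic (trans (cong (_* c) i≡i') (sym v≡i'c))))

collision-cases : ∀ {c} .{{_ : NonZero c}} {k s i i' m j} q → i ≢ i' → j ≤ m →
  i * c + (m + j * c) ≡ i' * c + q * (k * c + s) →
    (∃₂ λ q' t → i + j ≡ i' + suc q' * k + t × m + t * c ≡ suc q' * s)
  ⊎ (∃ λ t → m ≡ q * s + suc t * c × i' + q * k ≡ i + j + suc t)
collision-cases {c} {k} {s} {i} {i'} {m} {j} q i≢i' j≤m eq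
  with m+x*c≡r+y*c-cases m (i + j) c (q * s) (i' + q * k)
         (trans (regroupˡ i m j c) (trans eq (regroupʳ i' c q k s)))
  where
  regroupˡ : ∀ i m j c → m + (i + j) * c ≡ i * c + (m + j * c)
  regroupˡ = solve-∀
  regroupʳ : ∀ i' c q k s → i' * c + q * (k * c + s) ≡ q * s + (i' + q * k) * c
  regroupʳ = solve-∀
... | inj₂ (t , e , m≡) = inj₂ (t , m≡ , e)
... | inj₁ (t , e , m+tc≡qs) with q
...   | suc q' = inj₁ (q' , t , e , m+tc≡qs)
...   | zero = ⊥-elim (i≢i' i≡i')
  where
  t≡0 : t ≡ 0
  t≡0 = m*n≡0⇒m≡0 t c (m+n≡0⇒n≡0 m m+tc≡qs)
  j≡0 : j ≡ 0
  j≡0 = n≤0⇒n≡0 (subst (j ≤_) (m+n≡0⇒m≡0 m m+tc≡qs) j≤m)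
  i≡i' : i ≡ i'
  i≡i' = begin
    i           ≡⟨ +-identityʳ i ⟨
    i + 0       ≡⟨ cong (i +_) j≡0 ⟨
    i + j       ≡⟨ e ⟩
    i' + 0 + t  ≡⟨ cong₂ _+_ (+-identityʳ i') t≡0 ⟩
    i' + 0      ≡⟨ +-identityʳ i' ⟩
    i'          ∎
    where open ≡-Reasoning

no-wrap-if-i+s<k : ∀ {c k s i i' m j t} q → i + s < k → j ≤ m →
  i + j ≡ i' + suc q * k + t → m + t * c ≡ suc q * s → ⊥
no-wrap-if-i+s<k {c} {k} {s} {i} {i'} {m} {j} {t} q i+s<k j≤m e m+tc≡Qs = n≮n (i + m) (begin-strict
  i + m               ≡⟨ +-comm i m ⟩
  m + i               <⟨ +-monoʳ-< m (n<1+n i) ⟩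
  m + suc i           ≤⟨ +-mono-≤ (subst (m ≤_) m+tc≡Qs (m≤m+n m (t * c))) (m≤n*m (suc i) Q) ⟩
  Q * s + Q * suc i   ≡⟨ *-distribˡ-+ Q s (suc i) ⟨
  Q * (s + suc i)     ≤⟨ *-monoʳ-≤ Q s+suc-i≤k ⟩
  Q * k               ≤⟨ ≤-trans (m≤n+m (Q * k) i') (m≤m+n _ t) ⟩
  i' + Q * k + t      ≡⟨ e ⟨
  i + j               ≤⟨ +-monoʳ-≤ i j≤m ⟩
  i + m               ∎)
  where
  open ≤-Reasoning
  Q = suc q
  s+suc-i≤k : s + suc i ≤ k
  s+suc-i≤k = subst (_≤ k) (trans (cong suc (+-comm i s)) (sym (+-suc s i))) i+s<k

no-wrap-if-m<s : ∀ {c k s i i' m j t} q → s < c → s ≤ k → i ≤ k → m < s → j ≤ m →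
  i + j ≡ i' + suc q * k + t → m + t * c ≡ suc q * s → ⊥
no-wrap-if-m<s {t = zero} zero _ _ _ m<s _ _ m+0≡s+0 =
  <-irrefl (+-cancelʳ-≡ 0 _ _ m+0≡s+0) m<s
no-wrap-if-m<s {c} {s = s} {m = m} {t = suc t} zero s<c _ _ _ _ _ m+ct≡s+0 =
  <⇒≱ s<c (subst (c ≤_) (trans m+ct≡s+0 (+-identityʳ s)) (≤-trans (m≤m+n c (t * c)) (m≤n+m _ m)))
no-wrap-if-m<s {k = k} {i = i} {i'} {j = j} {t} (suc q) _ s≤k i≤k m<s j≤m e _ = <⇒≱ i+j<k+k (begin
  k + k                        ≤⟨ +-monoʳ-≤ k (m≤m+n k (q * k)) ⟩
  k + (k + q * k)              ≤⟨ m≤n+m _ i' ⟩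
  i' + (k + (k + q * k))       ≤⟨ m≤m+n _ t ⟩
  i' + (k + (k + q * k)) + t   ≡⟨ e ⟨
  i + j                        ∎)
  where
  open ≤-Reasoning
  i+j<k+k : i + j < k + k
  i+j<k+k = +-mono-≤-< i≤k (<-≤-trans (≤-<-trans j≤m m<s) s≤k)

layered : (k s c : ℕ) → ℕ → ℕ
layered k s c i with i + s <? k
... | yes _ = c ∸ 1
... | no _ = s ∸ 1

layered-cases : ∀ k s c i →
  (i + s < k × layered k s c i ≡ c ∸ 1) ⊎ (k ≤ i + s × layered k s c i ≡ s ∸ 1)
layered-cases k s c i with i + s <? k
... | yes i+s<k = inj₁ (i+s<k , refl)
... | no i+s≮k = inj₂ (≮⇒≥ i+s≮k , refl)

layered-below : ∀ {k s c i} → i + s < k → layered k s c i ≡ c ∸ 1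
layered-below {k} {s} {c} {i} i+s<k with layered-cases k s c i
... | inj₁ (_ , w≡) = w≡
... | inj₂ (k≤i+s , _) = contradiction i+s<k (≤⇒≯ k≤i+s)

layered-above : ∀ {k s c i} → k ≤ i + s → layered k s c i ≡ s ∸ 1
layered-above {k} {s} {c} {i} k≤i+s with layered-cases k s c i
... | inj₁ (i+s<k , _) = contradiction i+s<k (≤⇒≯ k≤i+s)
... | inj₂ (_ , w≡) = w≡

layered-< : ∀ {k s c} i → s < c → layered k s c i < c
layered-< {k} {s} {suc c} i (s≤s s≤c) with layered-cases k s (suc c) i
... | inj₁ (_ , w≡) = ≤-reflexive (cong suc w≡)
... | inj₂ (_ , w≡) = s≤s (subst (_≤ c) (sym w≡) (≤-trans (m∸n≤m s 1) s≤c))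

sumBelow-layered-prefix : ∀ {k s c} e → e + s ≤ k → sumBelow e (layered k s c) ≡ e * (c ∸ 1)
sumBelow-layered-prefix {k} {s} e e+s≤k =
  sumBelow-const e _ (λ i i<e → layered-below (<-≤-trans (+-monoˡ-< s i<e) e+s≤k))

sumBelow-layered : ∀ {k s c} → s ≤ k →
  sumBelow (suc k) (layered k s c) ≡ (k ∸ s) * (c ∸ 1) + suc s * (s ∸ 1)
sumBelow-layered {k} {s} {c} s≤k = begin
  sumBelow (suc k) w                                 ≡⟨ cong (λ N → sumBelow N w) suc-k≡e+suc-s ⟩
  sumBelow (e + suc s) w                             ≡⟨ sumBelow-+ e (suc s) w ⟩
  sumBelow e w + sumBelow (suc s) (λ i → w (e + i))  ≡⟨ cong₂ _+_ low high ⟩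
  e * (c ∸ 1) + suc s * (s ∸ 1)                      ∎
  where
  open ≡-Reasoning
  w = layered k s c
  e = k ∸ s
  e+s≡k : e + s ≡ k
  e+s≡k = m∸n+n≡m s≤k
  suc-k≡e+suc-s : suc k ≡ e + suc s
  suc-k≡e+suc-s = trans (cong suc (sym e+s≡k)) (sym (+-suc e s))
  low : sumBelow e w ≡ e * (c ∸ 1)
  low = sumBelow-layered-prefix e (≤-reflexive e+s≡k)
  high : sumBelow (suc s) (λ i → w (e + i)) ≡ suc s * (s ∸ 1)
  high = sumBelow-const (suc s) _ (λ i _ →
    layered-above (subst (_≤ e + i + s) e+s≡k (+-monoˡ-≤ s (m≤m+n e i))))

layered-collisionFree : ∀ {c k s} .{{_ : NonZero c}} → s < c → s ≤ k →
  CollisionFree c (k * c + s) (layered k s c)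
layered-collisionFree {c} {k} {s} s<c s≤k {i} {i'} {m} q i≢i' wi>0 _ ic<n j≤m m≤wi eq
  with collision-cases {k = k} {s} q i≢i' j≤m eq
... | inj₂ (t , m≡ , _) = <⇒≱ (≤-<-trans m≤wi (layered-< {k} i s<c))
    (subst (c ≤_) (sym m≡) (≤-trans (m≤m+n c (t * c)) (m≤n+m _ (q * s))))
... | inj₁ (q' , t , e , m+tc≡Qs) with layered-cases k s c i
...   | inj₁ (i+s<k , _) = no-wrap-if-i+s<k {c} {k} {s} {i} {i'} {t = t} q' i+s<k j≤m e m+tc≡Qs
...   | inj₂ (_ , wi≡) = no-wrap-if-m<s {c} {k} {s} {i} {i'} {t = t} q' s<c s≤k i≤k m<s j≤m e m+tc≡Qs
  where
  i≤k : i ≤ k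
  i≤k = ≤-pred (*-cancelʳ-< c i (suc k) (<-≤-trans ic<n (begin
    k * c + s   ≤⟨ +-monoʳ-≤ (k * c) (<⇒≤ s<c) ⟩
    k * c + c   ≡⟨ +-comm (k * c) c ⟩
    suc k * c   ∎)))
    where open ≤-Reasoning
  m<s : m < s
  m<s = m≤pred[n]⇒suc[m]≤n {{>-nonZero (<-≤-trans (subst (0 <_) wi≡ wi>0) (m∸n≤m s 1))}}
          (subst (m ≤_) wi≡ m≤wi)

peaked : (k c : ℕ) → ℕ → ℕ
peaked k c i with i + 2 ≟ k
... | yes _ = c
... | no _ = layered k 1 c i

peaked-cases : ∀ k c i → (i + 2 ≡ k × peaked k c i ≡ c) ⊎ (peaked k c i ≡ layered k 1 c i)
peaked-cases k c i with i + 2 ≟ k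
... | yes i+2≡k = inj₁ (i+2≡k , refl)
... | no _ = inj₂ refl

peaked-below : ∀ {k c i} → i + 2 < k → peaked k c i ≡ c ∸ 1
peaked-below {k} {c} {i} i+2<k with i + 2 ≟ k
... | yes i+2≡k = contradiction i+2≡k (<⇒≢ i+2<k)
... | no _ = layered-below (<-trans (+-monoʳ-< i (n<1+n 1)) i+2<k)

peaked-at-top : ∀ {k c i} → i + 2 ≡ k → peaked k c i ≡ c
peaked-at-top {k} {c} {i} i+2≡k with i + 2 ≟ k
... | yes _ = refl
... | no i+2≢k = contradiction i+2≡k i+2≢k

peaked-support : ∀ {k c} i → 0 < peaked k c i → i + 1 < k
peaked-support {k} {c} i pos with peaked-cases k c i
... | inj₁ (i+2≡k , _) = ≤-reflexive (trans (sym (+-suc i 1)) i+2≡k)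
... | inj₂ w≡ with layered-cases k 1 c i
...   | inj₁ (i+1<k , _) = i+1<k
...   | inj₂ (_ , w≡0) = contradiction (subst (0 <_) (trans w≡ w≡0) pos) (<-irrefl refl)

peaked-≤ : ∀ {k c} i → 1 < c → peaked k c i ≤ c
peaked-≤ {k} {c} i 1<c with peaked-cases k c i
... | inj₁ (_ , w≡) = ≤-reflexive w≡
... | inj₂ w≡ = <⇒≤ (subst (_< c) (sym w≡) (layered-< {k} i 1<c))

c≤peaked⇒i+2≡k : ∀ {k c} i → 1 < c → c ≤ peaked k c i → i + 2 ≡ k
c≤peaked⇒i+2≡k {k} {c} i 1<c c≤w with peaked-cases k c i
... | inj₁ (i+2≡k , _) = i+2≡k
... | inj₂ w≡ = contradiction (subst (c ≤_) w≡ c≤w) (<⇒≱ (layered-< {k} i 1<c))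

sumBelow-peaked : ∀ K c → sumBelow (suc K) (peaked (suc (suc K)) c) ≡ K * (c ∸ 1) + c
sumBelow-peaked K c = cong₂ _+_
  (sumBelow-const K _ (λ i i<K → peaked-below (subst (i + 2 <_) (+-comm K 2) (+-monoˡ-< 2 i<K))))
  (peaked-at-top (+-comm K 2))

peaked-collisionFree : ∀ {c k} .{{_ : NonZero c}} → 1 < c → CollisionFree c (k * c + 1) (peaked k c)
peaked-collisionFree {c} {k} 1<c {i} {i'} {m} {j} q i≢i' wi>0 wi'>0 _ j≤m m≤wi eq
  with collision-cases {k = k} {1} q i≢i' j≤m eq
... | inj₁ (q' , t , e , m+tc≡Q) =
  no-wrap-if-i+s<k {c} {k} {1} {i} {i'} {t = t} q' (peaked-support i wi>0) j≤m e m+tc≡Q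
... | inj₂ (t , m≡ , e) with q
...   | suc q' = <⇒≱ (s≤s (≤-trans (m≤m+n c (t * c)) (m≤n+m _ (q' * 1))))
                     (subst (_≤ c) m≡ (≤-trans m≤wi (peaked-≤ i 1<c)))
...   | zero = <⇒≱ i<i' i'≤i
  where
  i+2≡k : i + 2 ≡ k
  i+2≡k = c≤peaked⇒i+2≡k i 1<c (≤-trans (subst (c ≤_) (sym m≡) (m≤m+n c (t * c))) m≤wi)
  i<i' : i < i'
  i<i' = subst (i <_) (trans (sym e) (+-identityʳ i'))
           (≤-trans (m<m+n i {suc t} z<s) (+-monoˡ-≤ (suc t) (m≤m+n i j)))
  i'≤i : i' ≤ i
  i'≤i = +-cancelʳ-≤ 2 i' i (subst₂ _≤_ (sym (+-suc i' 1)) (sym i+2≡k) (peaked-support i' wi'>0))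

c<k*c+s : ∀ {c k} s .{{_ : NonZero c}} → 2 ≤ k → c < k * c + s
c<k*c+s {c} {suc (suc k)} s (s≤s (s≤s _)) =
  <-≤-trans (m<m+n c (>-nonZero⁻¹ c)) (≤-trans (+-monoʳ-≤ c (m≤m+n c (k * c))) (m≤m+n _ s))

β-≥-spaced : ∀ {c k s w b} .{{_ : NonZero c}} → s ≤ k → 2 ≤ k → (∀ i → w i ≤ c) →
  CollisionFree c (k * c + s) w → ∀ K → K * c < k * c + s → IsBetaB (k * c + s) (suc c) b →
  sumBelow (suc K) w ≤ b
β-≥-spaced {s = s} s≤k 2≤k w≤c collision-free K Kc<n (_ , maximal) = ≤-trans
  (cost-spaced _ K Kc<n)
  (maximal _ (spaced-independent s≤k (c<k*c+s s 2≤k) w≤c collision-free))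

β-≥-s≡0 : ∀ {c k s b} → s ≡ 0 → s < c → s + 2 ≤ k → IsBetaB (k * c + s) (suc c) b →
  k * (c ∸ 1) ≤ b
β-≥-s≡0 {c@(suc _)} {k@(suc K)} {b = b} refl s<c 2≤k β = begin
  k * (c ∸ 1)                 ≡⟨ sumBelow-layered-prefix {k} {0} {c} k (≤-reflexive (+-identityʳ k)) ⟨
  sumBelow k (layered k 0 c)  ≤⟨ β-≥-spaced {k = k} z≤n 2≤k (λ i → <⇒≤ (layered-< {k} i s<c))
                                   (layered-collisionFree s<c z≤n) K Kc<n β ⟩
  b                           ∎
  where
  open ≤-Reasoning
  Kc<n : K * c < k * c + 0
  Kc<n = subst (K * c <_) (sym (+-identityʳ (k * c))) (m<n+m (K * c) (>-nonZero⁻¹ c))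

β-≥-s≡1 : ∀ {c k s b} → s ≡ 1 → s < c → s + 2 ≤ k → IsBetaB (k * c + s) (suc c) b →
  (k ∸ 1) * (c ∸ 1) + 1 ≤ b
β-≥-s≡1 {c@(suc c')} {b = b} refl s<c (s≤s (s≤s {n = K} _)) β = begin
  suc K * (c ∸ 1) + 1            ≡⟨ regroup K c' ⟩
  K * (c ∸ 1) + c                ≡⟨ sumBelow-peaked K c ⟨
  sumBelow (suc K) (peaked k c)  ≤⟨ β-≥-spaced {k = k} (s≤s z≤n) (s≤s (s≤s z≤n))
                                      (λ i → peaked-≤ i s<c) (peaked-collisionFree s<c) K Kc<n β ⟩
  b                              ∎
  where
  open ≤-Reasoning
  k = suc (suc K)
  regroup : ∀ K c' → suc K * c' + 1 ≡ K * c' + suc c'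
  regroup = solve-∀
  Kc<n : K * c < k * c + 1
  Kc<n = ≤-trans (*-monoˡ-< c (≤-trans (n<1+n K) (n≤1+n (suc K)))) (m≤m+n (k * c) 1)

β-≥-s≥2 : ∀ {c k s b} → 2 ≤ s → s < c → s + 2 ≤ k → IsBetaB (k * c + s) (suc c) b →
  (k ∸ s) * (c ∸ 1) + (s ∸ 1) * (s + 1) ≤ b
β-≥-s≥2 {c@(suc _)} {k} {s} {b} 2≤s s<c s+2≤k β = begin
  (k ∸ s) * (c ∸ 1) + (s ∸ 1) * (s + 1)  ≡⟨ cong ((k ∸ s) * (c ∸ 1) +_) (s-1*s+1≡ s) ⟩
  (k ∸ s) * (c ∸ 1) + suc s * (s ∸ 1)    ≡⟨ sumBelow-layered s≤k ⟨
  sumBelow (suc k) (layered k s c)       ≤⟨ β-≥-spaced {k = k} s≤k (≤-trans (m≤n+m 2 s) s+2≤k)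
                                              (λ i → <⇒≤ (layered-< {k} i s<c))
                                              (layered-collisionFree s<c s≤k) k kc<n β ⟩
  b                                      ∎
  where
  open ≤-Reasoning
  s≤k : s ≤ k
  s≤k = ≤-trans (m≤m+n s 2) s+2≤k
  kc<n : k * c < k * c + s
  kc<n = m<m+n (k * c) (<-trans z<s 2≤s)
  s-1*s+1≡ : ∀ s → (s ∸ 1) * (s + 1) ≡ suc s * (s ∸ 1)
  s-1*s+1≡ s = trans (*-comm (s ∸ 1) (s + 1)) (cong (_* (s ∸ 1)) (+-comm s 1))

proposition19 :
    (n a k s : ℕ) → n ≡ k * (a ∸ 1) + s → 4 ≤ a → s + 2 ≤ a ⊓ k →
      ∀ b → IsBetaB n a b →
        (s ≡ 0 → k * (a ∸ 2) ≤ b)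
        × (s ≡ 1 → (k ∸ 1) * (a ∸ 2) + 1 ≤ b)
        × (2 ≤ s → (k ∸ s) * (a ∸ 2) + (s ∸ 1) * (s + 1) ≤ b)
proposition19 _ (suc c) k s refl _ s+2≤a⊓k b β =
    (λ s≡0 → β-≥-s≡0 s≡0 s<c s+2≤k β)
  , (λ s≡1 → β-≥-s≡1 s≡1 s<c s+2≤k β)
  , (λ 2≤s → β-≥-s≥2 2≤s s<c s+2≤k β)
  where
  s+2≤k : s + 2 ≤ k
  s+2≤k = ≤-trans s+2≤a⊓k (m⊓n≤n (suc c) k)
  s<c : s < c
  s<c = s≤s⁻¹ (subst (_≤ suc c) (+-comm s 2) (≤-trans s+2≤a⊓k (m⊓n≤m (suc c) k)))
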